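{- Let $n\ge 2$ and let $G$ be a graph on $2n+1$ vertices with at least $n^2+n$ edges such that $G$ contains no two distinct vertices of equal degree joined by a path of length three. Let $\beta$ be the largest integer such that $G$ contains two distinct vertices of degree $\beta$. Then $\beta\ge 3$.
   Context: Graphs are finite and simple. A path of length three joining $a$ and $b$ is a path $a\,x\,y\,b$ on four distinct vertices with three edges. -}

module Defs where

open import Data.Nat using (ℕ; zero; suc; _+_; _<ᵇ_; _≤_)
open import Data.Bool using (Bool; true; false; _∧_; T)
open import Data.Fin using (Fin; toℕ)
import Data.Fin as F
open import Data.Product using (Σ; _×_; ∃-syntax)
open import Relation.Binary.PropositionalEquality using (_≡_; _≢_)

count : ∀ {m} → (Fin m → Bool) → ℕ
count {zero}  p = 0
count {suc m} p = (if p F.zero then 1 else 0) + count (λ i → p (F.suc i))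
  where open import Data.Bool using (if_then_else_)

record Graph (m : ℕ) : Set where
  field
    adj     : Fin m → Fin m → Bool
    sym     : ∀ u v → adj u v ≡ adj v u
    irrefl  : ∀ v → adj v v ≡ false

open Graph public

Adj : ∀ {m} → Graph m → Fin m → Fin m → Set
Adj G u v = T (adj G u v)

degree : ∀ {m} → Graph m → Fin m → ℕ
degree G v = count (adj G v)

edgeCount : ∀ {m} → Graph m → ℕ
edgeCount {m} G = sumFin (λ i → count (λ j → (toℕ i <ᵇ toℕ j) ∧ adj G i j))
  where
  sumFin : ∀ {k} → (Fin k → ℕ) → ℕ
  sumFin {zero}  f = 0
  sumFin {suc k} f = f F.zero + sumFin (λ i → f (F.suc i))

PathOfLength3 : ∀ {m} → Graph m → Fin m → Fin m → Set
PathOfLength3 G a b = ∃[ x ] ∃[ y ]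
  ( a ≢ x × a ≢ y × a ≢ b × x ≢ y × x ≢ b × y ≢ b
  × Adj G a x × Adj G x y × Adj G y b )

HasTwoVerticesOfDegree : ∀ {m} → Graph m → ℕ → Set
HasTwoVerticesOfDegree G β = ∃[ u ] ∃[ v ] (u ≢ v × degree G u ≡ β × degree G v ≡ β)

IsLargestRepeatedDegree : ∀ {m} → Graph m → ℕ → Set
IsLargestRepeatedDegree G β =
  HasTwoVerticesOfDegree G β × (∀ γ → HasTwoVerticesOfDegree G γ → γ ≤ β)

-- Call distinct vertices of equal degree twins, and suppose all twins have degree at most 2,
-- so degrees above 2 are pairwise distinct. Writing each degree as (deg ⊓ t) + (deg ∸ t), the
-- parts above the threshold t are distinct, so twice their sum is at most d (d + 1) when they
-- are bounded by d; this keeps the degree sum below 2|E| ≥ 2n² + 2n in three cases. If no vertex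
-- has degree 2n, take t = 2, d = 2n − 3. If at most one vertex has degree 2, take t = 1,
-- d = 2n − 1. Otherwise there are twins a, b of degree 2 and a vertex u of degree 2n, adjacent
-- to all others; a neighbour x ∉ {u, b} of a would give the path a x u b, so N(a) = {u, b} and
-- N(b) = {u, a}. Hence every other vertex has degree at most 2n − 2 and none has degree 2, and
-- after setting u and b aside t = 1, d = 2n − 3 suffice.
module Submission where

open import Defs renaming (sym to adj-sym)
open import Data.Nat using (ℕ; zero; suc; _+_; _*_; _∸_; _⊓_; _≤_; _<_; z≤n; s≤s; s≤s⁻¹; z<s; _≟_)
open import Data.Nat.Properties
open import Data.Nat.Tactic.RingSolver using (solve-∀)
open import Data.Bool using (Bool; true; false; T; not; if_then_else_)
open import Data.Fin using (Fin; zero; suc) renaming (_≟_ to _≟ᶠ_)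
open import Data.Fin.Properties using (any?)
open import Data.List using (List; []; _∷_; length)
open import Data.List.Relation.Unary.All using (All; []; _∷_)
import Data.List.Relation.Unary.All as All
open import Data.List.Relation.Unary.Unique.Propositional using (Unique; []; _∷_)
open import Data.Product using (_,_)
open import Data.Sum using (_⊎_; inj₁; inj₂)
open import Data.Vec.Functional using (updateAt)
open import Data.Vec.Functional.Properties using (updateAt-updates; updateAt-minimal)
open import Algebra.Properties.CommutativeMonoid.Sum +-0-commutativeMonoid using (sum; sum-cong-≗; ∑-distrib-+)
open import Algebra.Properties.CommutativeSemigroup +-commutativeSemigroup using (x∙yz≈y∙xz)
open import Function using (_∘_; id; const)
open import Relation.Binary.PropositionalEquality
open import Relation.Nullary using (¬_; yes; no; contradiction; ¬?; _×-dec_)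
open import Relation.Nullary.Decidable using (T?)

private variable m : ℕ

zeroAt : (Fin m → ℕ) → Fin m → Fin m → ℕ
zeroAt f x = updateAt f x (const 0)

sum-map-zeroAt : (F : ℕ → ℕ) → F 0 ≡ 0 → (f : Fin m → ℕ) (x : Fin m) →
                 sum (F ∘ f) ≡ F (f x) + sum (F ∘ zeroAt f x)
sum-map-zeroAt F F0≡0 f zero    = cong (λ y → F (f zero) + (y + sum (F ∘ f ∘ suc))) (sym F0≡0)
sum-map-zeroAt F F0≡0 f (suc x) =
  trans (cong (F (f zero) +_) (sum-map-zeroAt F F0≡0 (f ∘ suc) x)) (x∙yz≈y∙xz (F (f zero)) (F (f (suc x))) _)

sum-zeroAt : (f : Fin m → ℕ) (x : Fin m) → sum f ≡ f x + sum (zeroAt f x)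
sum-zeroAt = sum-map-zeroAt id refl

zeroAt-≤ : ∀ {c} (f : Fin m → ℕ) x v → (v ≢ x → f v ≤ c) → zeroAt f x v ≤ c
zeroAt-≤ f x v bound with v ≟ᶠ x
... | yes refl = subst (_≤ _) (sym (updateAt-updates x f)) z≤n
... | no  v≢x  = subst (_≤ _) (sym (updateAt-minimal v x f v≢x)) (bound v≢x)

sum-≤ : ∀ {c} (f : Fin m → ℕ) → (∀ v → f v ≤ c) → sum f ≤ m * c
sum-≤ {zero}  f bound = z≤n
sum-≤ {suc m} f bound = +-mono-≤ (bound zero) (sum-≤ (f ∘ suc) (bound ∘ suc))

sum-⊓-∸ : ∀ t (f : Fin m → ℕ) → sum f ≡ sum (λ v → t ⊓ f v) + sum (λ v → f v ∸ t)
sum-⊓-∸ t f = trans (sum-cong-≗ (λ v → sym (m⊓n+n∸m≡n t (f v))))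
                    (∑-distrib-+ (λ v → t ⊓ f v) (λ v → f v ∸ t))

length≤sum : (f : Fin m → ℕ) (xs : List (Fin m)) → Unique xs → All (λ x → 1 ≤ f x) xs →
             length xs ≤ sum f
length≤sum f []       _                  _                = z≤n
length≤sum f (x ∷ xs) (x∉xs ∷ unique-xs) (1≤fx ∷ 1≤f-xs) = begin
  1 + length xs           ≤⟨ +-mono-≤ 1≤fx (length≤sum (zeroAt f x) xs unique-xs 1≤f-xs′) ⟩
  f x + sum (zeroAt f x)  ≡⟨ sum-zeroAt f x ⟨
  sum f                   ∎
  where
  open ≤-Reasoning
  1≤f-xs′ : All (λ y → 1 ≤ zeroAt f x y) xs
  1≤f-xs′ = All.zipWith (λ (x≢y , 1≤fy) → subst (1 ≤_) (sym (updateAt-minimal _ x f (x≢y ∘ sym))) 1≤fy)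
                        (x∉xs , 1≤f-xs)

sum-supported : (f : Fin m → ℕ) (x : Fin m) → (∀ v → v ≢ x → f v ≡ 0) → sum f ≡ f x
sum-supported {m} f x vanishes = begin
  sum f                   ≡⟨ sum-zeroAt f x ⟩
  f x + sum (zeroAt f x)  ≡⟨ cong (f x +_) (n≤0⇒n≡0 (≤-trans (sum-≤ (zeroAt f x) zero-everywhere) (≤-reflexive (*-zeroʳ m)))) ⟩
  f x + 0                 ≡⟨ +-identityʳ (f x) ⟩
  f x                     ∎
  where
  open ≡-Reasoning
  zero-everywhere : ∀ v → zeroAt f x v ≤ 0
  zero-everywhere v = zeroAt-≤ f x v (≤-reflexive ∘ vanishes v)

InjectiveAbove : ℕ → (Fin m → ℕ) → Set
InjectiveAbove t f = ∀ u v → t < f u → f u ≡ f v → u ≡ v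

zeroAt-injectiveAbove : ∀ {t} (f : Fin m → ℕ) x →
  (∀ u v → u ≢ x → v ≢ x → t < f u → f u ≡ f v → u ≡ v) → InjectiveAbove t (zeroAt f x)
zeroAt-injectiveAbove {t = t} f x injective u v t<f′u f′u≡f′v =
  injective u v (off u t<f′u) (off v t<f′v) (subst (t <_) (kept u t<f′u) t<f′u)
            (trans (sym (kept u t<f′u)) (trans f′u≡f′v (kept v t<f′v)))
  where
  t<f′v = subst (t <_) f′u≡f′v t<f′u
  off : ∀ w → t < zeroAt f x w → w ≢ x
  off w t<f′w refl = n≮0 (subst (t <_) (updateAt-updates x f) t<f′w)
  kept : ∀ w → t < zeroAt f x w → zeroAt f x w ≡ f w
  kept w t<f′w = updateAt-minimal w x f (off w t<f′w)

∸-injectiveAbove : ∀ t (f : Fin m → ℕ) → InjectiveAbove t f → InjectiveAbove 0 (λ v → f v ∸ t)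
∸-injectiveAbove t f injective u v 0<fu∸t fu∸t≡fv∸t = injective u v (above u 0<fu∸t)
  (∸-cancelʳ-≡ (<⇒≤ (above u 0<fu∸t)) (<⇒≤ (above v (subst (0 <_) fu∸t≡fv∸t 0<fu∸t))) fu∸t≡fv∸t)
  where
  above : ∀ w → 0 < f w ∸ t → t < f w
  above w = m∸n≢0⇒n<m ∘ n>0⇒n≢0

injectiveAbove0-sum-≤ : ∀ d (h : Fin m → ℕ) → InjectiveAbove 0 h → (∀ v → h v ≤ d) →
                        2 * sum h ≤ d * suc d
injectiveAbove0-sum-≤ {m} zero h _ h≤0 =
  *-monoʳ-≤ 2 (≤-trans (sum-≤ h h≤0) (≤-reflexive (*-zeroʳ m)))
injectiveAbove0-sum-≤ (suc d) h injective h≤ with any? (λ v → h v ≟ suc d)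
... | no ∄top = ≤-trans (injectiveAbove0-sum-≤ d h injective below) (*-mono-≤ (n≤1+n d) (n≤1+n (suc d)))
  where
  below : ∀ v → h v ≤ d
  below v = s≤s⁻¹ (≤∧≢⇒< (h≤ v) (λ hv≡ → ∄top (v , hv≡)))
... | yes (x , hx≡) = begin
  2 * sum h                             ≡⟨ cong (2 *_) (sum-zeroAt h x) ⟩
  2 * (h x + sum (zeroAt h x))          ≡⟨ cong (λ y → 2 * (y + sum (zeroAt h x))) hx≡ ⟩
  2 * (suc d + sum (zeroAt h x))        ≡⟨ *-distribˡ-+ 2 (suc d) _ ⟩
  2 * suc d + 2 * sum (zeroAt h x)      ≤⟨ +-monoʳ-≤ (2 * suc d) rest ⟩
  2 * suc d + d * suc d                 ≡⟨ triangle d ⟩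
  suc d * suc (suc d)                   ∎
  where
  open ≤-Reasoning
  below : ∀ v → zeroAt h x v ≤ d
  below v = zeroAt-≤ h x v λ v≢x → s≤s⁻¹ (≤∧≢⇒< (h≤ v) λ hv≡ →
    v≢x (sym (injective x v (subst (0 <_) (sym hx≡) z<s) (trans hx≡ (sym hv≡)))))
  rest : 2 * sum (zeroAt h x) ≤ d * suc d
  rest = injectiveAbove0-sum-≤ d (zeroAt h x)
           (zeroAt-injectiveAbove h x (λ u v _ _ → injective u v)) below
  triangle : ∀ d → 2 * suc d + d * suc d ≡ suc d * suc (suc d)
  triangle = solve-∀

injectiveAbove-sum-≤ : ∀ t d (f : Fin m → ℕ) → InjectiveAbove t f → (∀ v → f v ≤ t + d) →
                       2 * sum f ≤ 2 * (m * t) + d * suc d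
injectiveAbove-sum-≤ {m} t d f injective f≤ = begin
  2 * sum f                                  ≡⟨ cong (2 *_) (sum-⊓-∸ t f) ⟩
  2 * (sum low + sum high)                   ≡⟨ *-distribˡ-+ 2 (sum low) (sum high) ⟩
  2 * sum low + 2 * sum high                 ≤⟨ +-mono-≤ (*-monoʳ-≤ 2 (sum-≤ low (λ v → m⊓n≤m t (f v))))
                                                         (injectiveAbove0-sum-≤ d high
                                                            (∸-injectiveAbove t f injective)
                                                            (λ v → m≤n+o⇒m∸n≤o (f v) t (f≤ v))) ⟩
  2 * (m * t) + d * suc d                    ∎
  where
  open ≤-Reasoning
  low high : Fin m → ℕ
  low v = t ⊓ f v
  high v = f v ∸ t

indicator : Bool → ℕ
indicator b = if b then 1 else 0

count≡sum : (p : Fin m → Bool) → count p ≡ sum (indicator ∘ p)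
count≡sum {zero}  p = refl
count≡sum {suc m} p = cong (indicator (p zero) +_) (count≡sum (p ∘ suc))

Adj-sym : (G : Graph m) {u v : Fin m} → Adj G u v → Adj G v u
Adj-sym G {u} {v} = subst T (adj-sym G u v)

¬Adj-refl : (G : Graph m) (v : Fin m) → ¬ Adj G v v
¬Adj-refl G v = subst T (irrefl G v)

deleteZero : Graph (suc m) → Graph m
deleteZero G = record
  { adj    = λ u v → adj G (suc u) (suc v)
  ; sym    = λ u v → adj-sym G (suc u) (suc v)
  ; irrefl = irrefl G ∘ suc
  }

sum-degree≡2*edgeCount : (G : Graph m) → sum (degree G) ≡ 2 * edgeCount G
sum-degree≡2*edgeCount {zero}  G = refl
sum-degree≡2*edgeCount {suc m} G = begin
  degree G zero + sum (degree G ∘ suc)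
    ≡⟨ cong₂ _+_ degree-zero (∑-distrib-+ (indicator ∘ toZero) (degree G′)) ⟩
  c + (sum (indicator ∘ toZero) + sum (degree G′))
    ≡⟨ cong (λ y → c + (y + sum (degree G′))) sum-toZero ⟩
  c + (c + sum (degree G′))
    ≡⟨ cong (λ y → c + (c + y)) (sum-degree≡2*edgeCount G′) ⟩
  c + (c + 2 * edgeCount G′)
    ≡⟨ double c (edgeCount G′) ⟩
  2 * (c + edgeCount G′)
    ∎
  where
  open ≡-Reasoning
  G′ = deleteZero G
  fromZero toZero : Fin m → Bool
  fromZero v = adj G zero (suc v)
  toZero v = adj G (suc v) zero
  c = count fromZero
  degree-zero : degree G zero ≡ c
  degree-zero = cong (λ b → indicator b + c) (irrefl G zero)
  sum-toZero : sum (indicator ∘ toZero) ≡ c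
  sum-toZero = trans (sum-cong-≗ (cong indicator ∘ λ v → adj-sym G (suc v) zero)) (sym (count≡sum fromZero))
  double : ∀ c e → c + (c + 2 * e) ≡ 2 * (c + e)
  double = solve-∀

1≤indicator-not : ∀ b → ¬ T b → 1 ≤ indicator (not b)
1≤indicator-not false _  = s≤s z≤n
1≤indicator-not true  ¬t = contradiction _ ¬t

indicator≤1 : ∀ b → indicator b ≤ 1
indicator≤1 false = z≤n
indicator≤1 true  = s≤s z≤n

indicator≡0 : ∀ b → ¬ T b → indicator b ≡ 0
indicator≡0 false _  = refl
indicator≡0 true  ¬t = contradiction _ ¬t

indicator+indicator-not≤1 : ∀ b → indicator b + indicator (not b) ≤ 1
indicator+indicator-not≤1 false = s≤s z≤n
indicator+indicator-not≤1 true  = s≤s z≤n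

degree+nonNeighbours≤ : (G : Graph m) (w : Fin m) (xs : List (Fin m)) →
                        Unique xs → All (λ x → ¬ Adj G w x) xs → degree G w + length xs ≤ m
degree+nonNeighbours≤ {m} G w xs unique-xs nonAdjacent = begin
  degree G w + length xs    ≤⟨ +-monoʳ-≤ (degree G w) (length≤sum missing xs unique-xs
                                 (All.map (λ {x} → 1≤indicator-not (adj G w x)) nonAdjacent)) ⟩
  degree G w + sum missing  ≡⟨ cong (_+ sum missing) (count≡sum (adj G w)) ⟩
  sum present + sum missing ≡⟨ ∑-distrib-+ present missing ⟨
  sum (λ v → present v + missing v) ≤⟨ sum-≤ _ (λ v → indicator+indicator-not≤1 (adj G w v)) ⟩
  m * 1                     ≡⟨ *-identityʳ m ⟩
  m                         ∎
  where
  open ≤-Reasoning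
  present missing : Fin m → ℕ
  present v = indicator (adj G w v)
  missing v = indicator (not (adj G w v))

degree≤ : ∀ {k} (G : Graph (suc k)) v → degree G v ≤ k
degree≤ {k} G v = +-cancelʳ-≤ 1 (degree G v) k
  (subst (degree G v + 1 ≤_) (+-comm 1 k) (degree+nonNeighbours≤ G v (v ∷ []) ([] ∷ []) (¬Adj-refl G v ∷ [])))

maxDegree⇒adjacent : ∀ {k} (G : Graph (suc k)) {u} → degree G u ≡ k → ∀ x → x ≢ u → Adj G u x
maxDegree⇒adjacent {k} G {u} du≡k x x≢u with T? (adj G u x)
... | yes u~x = u~x
... | no  u≁x = contradiction (s≤s⁻¹ (subst (_≤ suc k) (trans (cong (_+ 2) du≡k) (+-suc k 1))
                 (degree+nonNeighbours≤ G u (u ∷ x ∷ []) (((x≢u ∘ sym) ∷ []) ∷ [] ∷ [])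
                   (¬Adj-refl G u ∷ u≁x ∷ [])))) (m+1+n≰m k)

NoTwinPath₃ : Graph m → Set
NoTwinPath₃ G = ∀ u v → u ≢ v → degree G u ≡ degree G v → ¬ PathOfLength3 G u v

-- Otherwise a x u b is a path of length three between the twins a and b.
twin-neighbour : (G : Graph m) → NoTwinPath₃ G → ∀ {u} → (∀ x → x ≢ u → Adj G u x) →
                 ∀ {a b x} → a ≢ b → degree G a ≡ degree G b → a ≢ u → b ≢ u →
                 Adj G a x → x ≡ u ⊎ x ≡ b
twin-neighbour G noPath {u} universal {a} {b} {x} a≢b da≡db a≢u b≢u a~x with x ≟ᶠ u | x ≟ᶠ b
... | yes x≡u | _        = inj₁ x≡u
... | no  _   | yes x≡b  = inj₂ x≡b
... | no  x≢u | no  x≢b  = contradiction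
  (x , u , a≢x , a≢u , a≢b , x≢u , x≢b , b≢u ∘ sym , a~x , Adj-sym G (universal x x≢u) , universal b b≢u)
  (noPath a b a≢b da≡db)
  where
  a≢x : a ≢ x
  a≢x refl = ¬Adj-refl G a a~x

injectiveAbove-mono : ∀ {s t} {f : Fin m → ℕ} → s ≤ t → InjectiveAbove s f → InjectiveAbove t f
injectiveAbove-mono s≤t injective u v t<fu = injective u v (≤-<-trans s≤t t<fu)

repeatedDegrees≤⇒injectiveAbove : (G : Graph m) {β : ℕ} →
  (∀ γ → HasTwoVerticesOfDegree G γ → γ ≤ β) → InjectiveAbove β (degree G)
repeatedDegrees≤⇒injectiveAbove G maximal u v β<du du≡dv with u ≟ᶠ v
... | yes u≡v = u≡v
... | no  u≢v = contradiction (maximal _ (u , v , u≢v , refl , sym du≡dv)) (<⇒≱ β<du)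

edges≤⇒sum-degree≥ : ∀ {k} (G : Graph m) → k ≤ edgeCount G → 4 * k ≤ 2 * sum (degree G)
edges≤⇒sum-degree≥ {k = k} G k≤e = begin
  4 * k                     ≤⟨ *-monoʳ-≤ 4 k≤e ⟩
  4 * edgeCount G           ≡⟨ *-assoc 2 2 (edgeCount G) ⟩
  2 * (2 * edgeCount G)     ≡⟨ cong (2 *_) (sum-degree≡2*edgeCount G) ⟨
  2 * sum (degree G)        ∎
  where open ≤-Reasoning

<-by-gap : ∀ {a b} g → a + suc g ≡ b → a < b
<-by-gap {a} g a+1+g≡b = subst (a <_) a+1+g≡b (m<m+n a z<s)

module _ (k : ℕ) (G : Graph (suc (2 * (2 + k)))) (noPath : NoTwinPath₃ G)
         (injective : InjectiveAbove 2 (degree G)) where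
  private
    n = 2 + k
    deg = degree G

    2n≡ : 2 * n ≡ 4 + 2 * k
    2n≡ = *-distribˡ-+ 2 2 k

  sum-degree<-noMaxDegree : (∀ v → deg v ≢ 2 * n) → 2 * sum deg < 4 * (n * n + n)
  sum-degree<-noMaxDegree ∄max = begin-strict
    2 * sum deg                                         ≤⟨ injectiveAbove-sum-≤ 2 (1 + 2 * k) deg injective below ⟩
    2 * (suc (2 * n) * 2) + (1 + 2 * k) * (2 + 2 * k)   <⟨ <-by-gap (6 * k + 1) (gap k) ⟩
    4 * (n * n + n)                                     ∎
    where
    open ≤-Reasoning
    below : ∀ v → deg v ≤ 2 + (1 + 2 * k)
    below v = s≤s⁻¹ (subst (deg v <_) 2n≡ (≤∧≢⇒< (degree≤ G v) (∄max v)))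
    gap : ∀ k → 2 * (suc (2 * (2 + k)) * 2) + (1 + 2 * k) * (2 + 2 * k) + suc (6 * k + 1)
              ≡ 4 * ((2 + k) * (2 + k) + (2 + k))
    gap = solve-∀

  sum-degree<-uniqueDegree2 : (∀ a b → deg a ≡ 2 → deg b ≡ 2 → a ≡ b) → 2 * sum deg < 4 * (n * n + n)
  sum-degree<-uniqueDegree2 unique2 = begin-strict
    2 * sum deg                                         ≤⟨ injectiveAbove-sum-≤ 1 (3 + 2 * k) deg injective₁ below ⟩
    2 * (suc (2 * n) * 1) + (3 + 2 * k) * (4 + 2 * k)   <⟨ <-by-gap (2 * k + 1) (gap k) ⟩
    4 * (n * n + n)                                     ∎
    where
    open ≤-Reasoning
    injective₁ : InjectiveAbove 1 deg
    injective₁ u v 1<du du≡dv with m≤n⇒m<n∨m≡n 1<du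
    ... | inj₁ 2<du = injective u v 2<du du≡dv
    ... | inj₂ 2≡du = unique2 u v (sym 2≡du) (trans (sym du≡dv) (sym 2≡du))
    below : ∀ v → deg v ≤ 1 + (3 + 2 * k)
    below v = subst (deg v ≤_) 2n≡ (degree≤ G v)
    gap : ∀ k → 2 * (suc (2 * (2 + k)) * 1) + (3 + 2 * k) * (4 + 2 * k) + suc (2 * k + 1)
              ≡ 4 * ((2 + k) * (2 + k) + (2 + k))
    gap = solve-∀

  module _ {a b u} (a≢b : a ≢ b) (da : deg a ≡ 2) (db : deg b ≡ 2) (du : deg u ≡ 2 * n) where
    private
      universal : ∀ x → x ≢ u → Adj G u x
      universal = maxDegree⇒adjacent G du

      degree2⇒≢u : ∀ {v} → deg v ≡ 2 → v ≢ u
      degree2⇒≢u dv refl with trans (sym dv) (trans du 2n≡)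
      ... | ()

      neighbour-of-a : ∀ {x} → Adj G a x → x ≡ u ⊎ x ≡ b
      neighbour-of-a = twin-neighbour G noPath universal a≢b (trans da (sym db))
                                      (degree2⇒≢u da) (degree2⇒≢u db)

      neighbour-of-b : ∀ {x} → Adj G b x → x ≡ u ⊎ x ≡ a
      neighbour-of-b = twin-neighbour G noPath universal (a≢b ∘ sym) (trans db (sym da))
                                      (degree2⇒≢u db) (degree2⇒≢u da)

      ¬Adj-a : ∀ {v} → v ≢ u → v ≢ b → ¬ Adj G v a
      ¬Adj-a v≢u v≢b v~a with neighbour-of-a (Adj-sym G v~a)
      ... | inj₁ v≡u = v≢u v≡u
      ... | inj₂ v≡b = v≢b v≡b

      ¬Adj-b : ∀ {v} → v ≢ u → v ≢ a → ¬ Adj G v b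
      ¬Adj-b v≢u v≢a v~b with neighbour-of-b (Adj-sym G v~b)
      ... | inj₁ v≡u = v≢u v≡u
      ... | inj₂ v≡a = v≢a v≡a

      degree2⇒a : ∀ v → v ≢ b → deg v ≡ 2 → v ≡ a
      degree2⇒a v v≢b dv with v ≟ᶠ a
      ... | yes v≡a = v≡a
      ... | no  v≢a = contradiction (subst (_≤ 1) dv deg-v≤1) λ { (s≤s ()) }
        where
        v≢u = degree2⇒≢u dv
        only-u : ∀ {y} → Adj G v y → y ≡ u
        only-u {y} v~y with twin-neighbour G noPath universal v≢a (trans dv (sym da)) v≢u (degree2⇒≢u da) v~y
        ... | inj₁ y≡u = y≡u
        ... | inj₂ refl = contradiction v~y (¬Adj-a v≢u v≢b)
        deg-v≤1 : deg v ≤ 1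
        deg-v≤1 = begin
          deg v                           ≡⟨ count≡sum (adj G v) ⟩
          sum (indicator ∘ adj G v)       ≡⟨ sum-supported (indicator ∘ adj G v) u
                                               (λ y y≢u → indicator≡0 (adj G v y) (y≢u ∘ only-u)) ⟩
          indicator (adj G v u)           ≤⟨ indicator≤1 (adj G v u) ⟩
          1                               ∎
          where open ≤-Reasoning

      others≤ : ∀ v → v ≢ u → v ≢ a → v ≢ b → deg v ≤ 2 + 2 * k
      others≤ v v≢u v≢a v≢b = +-cancelʳ-≤ 3 (deg v) (2 + 2 * k)
        (subst (deg v + 3 ≤_) (room k)
          (degree+nonNeighbours≤ G v (v ∷ a ∷ b ∷ []) ((v≢a ∷ v≢b ∷ []) ∷ (a≢b ∷ []) ∷ [] ∷ [])
            (¬Adj-refl G v ∷ ¬Adj-a v≢u v≢b ∷ ¬Adj-b v≢u v≢a ∷ [])))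
        where
        room : ∀ k → suc (2 * (2 + k)) ≡ 2 + 2 * k + 3
        room = solve-∀

      trimmed : Fin (suc (2 * n)) → ℕ
      trimmed = zeroAt (zeroAt deg b) u

      trimmed≤ : ∀ v → trimmed v ≤ 1 + (1 + 2 * k)
      trimmed≤ v = zeroAt-≤ (zeroAt deg b) u v λ v≢u → zeroAt-≤ deg b v λ v≢b → ≤-off-u-b v v≢u v≢b
        where
        ≤-off-u-b : ∀ v → v ≢ u → v ≢ b → deg v ≤ 2 + 2 * k
        ≤-off-u-b v v≢u v≢b with v ≟ᶠ a
        ... | yes refl = subst (_≤ 2 + 2 * k) (sym da) (m≤m+n 2 (2 * k))
        ... | no  v≢a  = others≤ v v≢u v≢a v≢b

      trimmed-injective : InjectiveAbove 1 trimmed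
      trimmed-injective = zeroAt-injectiveAbove (zeroAt deg b) u λ v w _ _ →
        zeroAt-injectiveAbove deg b off-b v w
        where
        off-b : ∀ v w → v ≢ b → w ≢ b → 1 < deg v → deg v ≡ deg w → v ≡ w
        off-b v w v≢b w≢b 1<dv dv≡dw with m≤n⇒m<n∨m≡n 1<dv
        ... | inj₁ 2<dv = injective v w 2<dv dv≡dw
        ... | inj₂ 2≡dv = trans (degree2⇒a v v≢b (sym 2≡dv)) (sym (degree2⇒a w w≢b (trans (sym dv≡dw) (sym 2≡dv))))

    sum-degree<-twinsOfDegree2 : 2 * sum deg < 4 * (n * n + n)
    sum-degree<-twinsOfDegree2 = begin-strict
      2 * sum deg                                  ≡⟨ cong (2 *_) split ⟩
      2 * (low + (1 + (3 + 2 * k + high)))         ≡⟨ regroup low high k ⟩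
      2 * low + (2 * (4 + 2 * k) + 2 * high)       ≤⟨ +-mono-≤ (*-monoʳ-≤ 2 (sum-≤ _ (λ v → m⊓n≤m 1 (deg v))))
                                                                (+-monoʳ-≤ (2 * (4 + 2 * k)) high-bound) ⟩
      2 * (suc (2 * n) * 1) + (2 * (4 + 2 * k) + (1 + 2 * k) * (2 + 2 * k))
                                                   <⟨ <-by-gap (6 * k + 3) (gap k) ⟩
      4 * (n * n + n)                              ∎
      where
      open ≤-Reasoning
      low = sum (λ v → 1 ⊓ deg v)
      high = sum (λ v → trimmed v ∸ 1)
      high-bound : 2 * high ≤ (1 + 2 * k) * (2 + 2 * k)
      high-bound = injectiveAbove0-sum-≤ (1 + 2 * k) (λ v → trimmed v ∸ 1)
                     (∸-injectiveAbove 1 trimmed trimmed-injective)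
                     (λ v → m≤n+o⇒m∸n≤o (trimmed v) 1 (trimmed≤ v))
      split : sum deg ≡ low + (1 + (3 + 2 * k + high))
      split = begin-equality
        sum deg                                                       ≡⟨ sum-⊓-∸ 1 deg ⟩
        low + sum (λ v → deg v ∸ 1)                                   ≡⟨ cong (low +_) (sum-map-zeroAt (_∸ 1) refl deg b) ⟩
        low + (deg b ∸ 1 + sum (λ v → zeroAt deg b v ∸ 1))            ≡⟨ cong (λ y → low + (deg b ∸ 1 + y))
                                                                            (sum-map-zeroAt (_∸ 1) refl (zeroAt deg b) u) ⟩
        low + (deg b ∸ 1 + (zeroAt deg b u ∸ 1 + high))               ≡⟨ cong (λ y → low + (deg b ∸ 1 + (y ∸ 1 + high)))
                                                                            (updateAt-minimal u b deg (degree2⇒≢u db ∘ sym)) ⟩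
        low + (deg b ∸ 1 + (deg u ∸ 1 + high))                        ≡⟨ cong₂ (λ x y → low + (x ∸ 1 + (y ∸ 1 + high))) db (trans du 2n≡) ⟩
        low + (1 + (3 + 2 * k + high))                                ∎
      regroup : ∀ l h k → 2 * (l + (1 + (3 + 2 * k + h))) ≡ 2 * l + (2 * (4 + 2 * k) + 2 * h)
      regroup = solve-∀
      gap : ∀ k → 2 * (suc (2 * (2 + k)) * 1) + (2 * (4 + 2 * k) + (1 + 2 * k) * (2 + 2 * k)) + suc (6 * k + 3)
                ≡ 4 * ((2 + k) * (2 + k) + (2 + k))
      gap = solve-∀

  sum-degree< : 2 * sum deg < 4 * (n * n + n)
  sum-degree< with any? (λ a → any? (λ b → ¬? (a ≟ᶠ b) ×-dec deg a ≟ 2 ×-dec deg b ≟ 2))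
  ... | no ∄twins = sum-degree<-uniqueDegree2 unique2
    where
    unique2 : ∀ a b → deg a ≡ 2 → deg b ≡ 2 → a ≡ b
    unique2 a b da db with a ≟ᶠ b
    ... | yes a≡b = a≡b
    ... | no  a≢b = contradiction (a , b , a≢b , da , db) ∄twins
  ... | yes (a , b , a≢b , da , db) with any? (λ u → deg u ≟ 2 * n)
  ...   | no  ∄max    = sum-degree<-noMaxDegree (λ v dv → ∄max (v , dv))
  ...   | yes (u , du) = sum-degree<-twinsOfDegree2 a≢b da db du

lemma2p4 : (n : ℕ) → 2 ≤ n → (G : Graph (suc (2 * n)))
    → n * n + n ≤ edgeCount G
    → (∀ u v → u ≢ v → degree G u ≡ degree G v → ¬ PathOfLength3 G u v)
    → (β : ℕ) → IsLargestRepeatedDegree G β → 3 ≤ β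
lemma2p4 (suc (suc k)) (s≤s (s≤s z≤n)) G edges noPath β (_ , maximal) = ≮⇒≥ λ β<3 →
  <⇒≱ (sum-degree< k G noPath
         (injectiveAbove-mono (s≤s⁻¹ β<3) (repeatedDegrees≤⇒injectiveAbove G maximal)))
      (edges≤⇒sum-degree≥ G edges)
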